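{- For $n\ge2$ and all integers $k$ (with the convention that quantities with negative second index are $0$), $$P^+(n+1,k)=(k+1)P^+(n,k)+(n-2k)P^+(n,k-1)+P^-(n,k),$$ $$P^-(n+1,k)=(k+1)P^-(n,k)+(n-2k+1)P^-(n,k-1)+P^+(n,k-1).$$ Equivalently, $$P_{n+1}^+(x)=((n-2)x+1)P_{n}^+(x)+x(1-2x)\tfrac{d}{dx}P_{n}^+(x)+P_{n}^-(x),$$ $$P_{n+1}^-(x)=((n-1)x+1)P_{n}^-(x)+x(1-2x)\tfrac{d}{dx}P_{n}^-(x)+xP_{n}^+(x).$$
   Context: A permutation $\pi\in\mathfrak{S}_n$ is called simsun if for every $k$, the subword of $\pi$ consisting of the letters in $[k]$ (in the order they appear) contains no three consecutive entries $a>b>c$ (no double descent). Let $\mathcal{RS}_n$ be the set of simsun permutations of $[n]$, $\mathcal{RS}_n^+=\{\pi\in\mathcal{RS}_n:\pi(1)>\pi(2)\}$, $\mathcal{RS}_n^-=\{\pi\in\mathcal{RS}_n:\pi(1)<\pi(2)\}$. An interior peak of $\pi$ is an index $i\in\{2,\dots,n-1\}$ with $\pi(i-1)<\pi(i)>\pi(i+1)$, and ${\rm pk}(\pi)$ is their number. Let $P^{\pm}(n,k)=\#\{\pi\in\mathcal{RS}_n^{\pm}:{\rm pk}(\pi)=k\}$ and $P^{\pm}_n(x)=\sum_k P^{\pm}(n,k)x^k$. -}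

module Defs where

open import Data.Nat using (ℕ; zero; suc; _+_; _<ᵇ_; _≡ᵇ_)
open import Data.Integer using (ℤ; +_; -[1+_])
open import Data.Bool using (Bool; true; false; _∧_; _∨_; not; if_then_else_)
open import Data.List using (List; []; _∷_; map; concatMap; filterᵇ; length)
open import Data.Bool.ListAction using (all; any)

oneTo : ℕ → List ℕ
oneTo zero = []
oneTo (suc n) = oneTo n Data.List.++ (suc n ∷ [])

words : ℕ → ℕ → List (List ℕ)
words n zero = [] ∷ []
words n (suc m) = concatMap (λ a → map (a ∷_) (words n m)) (oneTo n)

distinct : List ℕ → Bool
distinct [] = true
distinct (a ∷ w) = not (any (λ b → a ≡ᵇ b) w) ∧ distinct w

perms : ℕ → List (List ℕ)
perms n = filterᵇ distinct (words n n)

noDoubleDescent : List ℕ → Bool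
noDoubleDescent (a ∷ b ∷ c ∷ w) = not ((b <ᵇ a) ∧ (c <ᵇ b)) ∧ noDoubleDescent (b ∷ c ∷ w)
noDoubleDescent _ = true

restrict : ℕ → List ℕ → List ℕ
restrict k = filterᵇ (λ x → x <ᵇ suc k)

simsun : ℕ → List ℕ → Bool
simsun n π = all (λ k → noDoubleDescent (restrict k π)) (oneTo n)

startsDescent : List ℕ → Bool
startsDescent (a ∷ b ∷ _) = b <ᵇ a
startsDescent _ = false

startsAscent : List ℕ → Bool
startsAscent (a ∷ b ∷ _) = a <ᵇ b
startsAscent _ = false

pk : List ℕ → ℕ
pk (a ∷ b ∷ c ∷ w) = (if (a <ᵇ b) ∧ (c <ᵇ b) then 1 else 0) + pk (b ∷ c ∷ w)
pk _ = 0

P⁺ℕ : ℕ → ℕ → ℕ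
P⁺ℕ n k = length (filterᵇ (λ π → simsun n π ∧ startsDescent π ∧ (pk π ≡ᵇ k)) (perms n))

P⁻ℕ : ℕ → ℕ → ℕ
P⁻ℕ n k = length (filterᵇ (λ π → simsun n π ∧ startsAscent π ∧ (pk π ≡ᵇ k)) (perms n))

P⁺ : ℕ → ℤ → ℤ
P⁺ n (+ k) = + P⁺ℕ n k
P⁺ n -[1+ _ ] = + 0

P⁻ : ℕ → ℤ → ℤ
P⁻ n (+ k) = + P⁻ℕ n k
P⁻ n -[1+ _ ] = + 0

-- Every permutation of [n + 1] arises exactly once by inserting n + 1 into a permutation π of [n], and it is
-- simsun exactly when π is simsun and n + 1 is not placed right before a descent. Let π be simsun with p peaks.
-- Inserting n + 1 in front, right after a peak or at the end keeps p peaks; every other admissible position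
-- creates one more peak. Only the insertions in front of π(1) and between π(1) and π(2) can change whether the word
-- starts with a descent or an ascent. Hence if π starts with a descent, its admissible insertions starting with
-- a descent are p + 1 words with p peaks and n − 2p − 2 words with p + 1 peaks, and exactly one insertion starts
-- with an ascent, with p + 1 peaks; if π starts with an ascent, exactly one insertion (in front) starts with a
-- descent, with p peaks, and the others are p + 1 words with p peaks and n − 2p − 1 with p + 1 peaks.
-- Summing over π gives both recurrences.
module Submission where

module PeakRecurrence where

  open import Defs
  open import Data.Bool using (Bool; true; false; _∧_; not; if_then_else_; T; T?)
  open import Data.Bool.ListAction using (all; and; any)
  open import Data.Bool.Properties using (∧-zeroʳ; ∧-identityʳ; ∧-assoc; ∧-conicalˡ; ∧-conicalʳ; T-≡)
  open import Data.Empty using (⊥-elim)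
  open import Data.List using (List; []; _∷_; _++_; map; length; concatMap; filterᵇ)
  open import Data.List.Membership.Propositional using (_∈_; _∉_; find; lose)
  open import Data.List.Membership.Propositional.Properties
    using (∈-map⁺; ∈-map⁻; ∈-++⁺ˡ; ∈-++⁺ʳ; ∈-++⁻; ∈-∃++; ∈-concatMap⁺; ∈-concatMap⁻;
           ∈-filter⁺; ∈-filter⁻)
  open import Data.List.Membership.Propositional.Properties.WithK using (unique∧set⇒bag)
  open import Data.List.Properties
    using (map-∘; map-cong-local; ∷-injective; length-++; filter-++; filter-all; filter-reject)
  open import Data.List.Relation.Binary.BagAndSetEquality using (∼bag⇒↭)
  open import Data.List.Relation.Binary.Disjoint.Propositional using (Disjoint)
  open import Data.List.Relation.Binary.Permutation.Propositional using (_↭_; ↭-sym; ↭⇒↭ₛ)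
  open import Data.List.Relation.Binary.Permutation.Propositional.Properties
    using (shift; ↭-length; ∈-resp-↭; All-resp-↭; filter-↭)
  open import Data.List.Relation.Unary.All as All using (All; []; _∷_)
  import Data.List.Relation.Unary.All.Properties as All
  open import Data.List.Relation.Unary.AllPairs as AllPairs using (AllPairs; []; _∷_)
  import Data.List.Relation.Unary.AllPairs.Properties as AllPairs
  open import Data.List.Relation.Unary.Any using (here; there)
  open import Data.List.Relation.Unary.Linked using (Linked; _∷_)
  open import Data.List.Relation.Unary.Linked.Properties using (AllPairs⇒Linked)
  open import Data.List.Relation.Unary.Unique.Propositional using (Unique)
  import Data.List.Relation.Unary.Unique.Propositional.Properties as Unique
  open import Data.Nat using (ℕ; zero; suc; _+_; _*_; _<ᵇ_; _≡ᵇ_; _<_; _≤_; z≤n; s≤s; _≟_)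
  open import Data.Nat.ListAction using (sum)
  open import Data.Nat.Properties
    using (<ᵇ⇒<; <⇒<ᵇ; ≡ᵇ⇒≡; ≡⇒≡ᵇ; <⇒≱; ≤∧≢⇒<; ≮⇒≥; <⇒≤; <-irrefl; ≤-refl; m≤n⇒m≤1+n; n<1+n;
           suc-injective; +-identityʳ; +-comm; <-cmp; module ≤-Reasoning)
  open import Data.Nat.Tactic.RingSolver using (solve-∀)
  open import Data.Product using (∃-syntax; ∃₂; _×_; _,_; proj₁; proj₂)
  open import Data.Sum using (inj₁; inj₂)
  open import Function using (_∘_; const; _⇔_; mk⇔)
  open import Function.Bundles using (Equivalence)
  open import Relation.Binary.Definitions using (Tri; tri<; tri≈; tri>)
  open import Relation.Nullary using (¬_; yes; no)
  open import Relation.Binary.PropositionalEquality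
    using (_≡_; _≢_; refl; sym; trans; cong; cong₂; subst; module ≡-Reasoning) renaming (setoid to ≡-setoid)
  open import Data.List.Membership.DecPropositional _≟_ using (_∈?_)
  open import Data.List.Relation.Binary.Permutation.Setoid.Properties (≡-setoid ℕ) using (Unique-resp-↭)

  <ᵇ-true : ∀ {m n} → m < n → (m <ᵇ n) ≡ true
  <ᵇ-true m<n = Equivalence.to T-≡ (<⇒<ᵇ m<n)

  <ᵇ-false : ∀ {m n} → n ≤ m → (m <ᵇ n) ≡ false
  <ᵇ-false {m} {n} n≤m with m <ᵇ n in e
  ... | false = refl
  ... | true = ⊥-elim (<⇒≱ (<ᵇ⇒< m n (subst T (sym e) _)) n≤m)

  <ᵇ-reverse : ∀ {m n} → m < n → (n <ᵇ m) ≡ false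
  <ᵇ-reverse m<n = <ᵇ-false (<⇒≤ m<n)

  <ᵇ-swap : ∀ {m n} → m ≢ n → (n <ᵇ m) ≡ false → (m <ᵇ n) ≡ true
  <ᵇ-swap m≢n e = <ᵇ-true (≤∧≢⇒< (≮⇒≥ λ n<m → subst T e (<⇒<ᵇ n<m)) m≢n)

  -- Permutations of [n + 1] as insertions of n + 1

  insertions : ℕ → List ℕ → List (List ℕ)
  insertions N [] = (N ∷ []) ∷ []
  insertions N (a ∷ w) = (N ∷ a ∷ w) ∷ map (a ∷_) (insertions N w)

  ∈-insertions⁻ : ∀ N π {w} → w ∈ insertions N π → ∃₂ λ u v → π ≡ u ++ v × w ≡ u ++ N ∷ v
  ∈-insertions⁻ N [] (here refl) = [] , [] , refl , refl
  ∈-insertions⁻ N (a ∷ π) (here refl) = [] , a ∷ π , refl , refl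
  ∈-insertions⁻ N (a ∷ π) (there w∈) with ∈-map⁻ (a ∷_) w∈
  ... | w′ , w′∈ , refl with ∈-insertions⁻ N π w′∈
  ... | u , v , refl , refl = a ∷ u , v , refl , refl

  ∈-insertions⁺ : ∀ N u v → u ++ N ∷ v ∈ insertions N (u ++ v)
  ∈-insertions⁺ N [] [] = here refl
  ∈-insertions⁺ N [] (a ∷ v) = here refl
  ∈-insertions⁺ N (a ∷ u) v = there (∈-map⁺ (a ∷_) (∈-insertions⁺ N u v))

  insertions-unique : ∀ N π → N ∉ π → Unique (insertions N π)
  insertions-unique N [] _ = [] ∷ []
  insertions-unique N (a ∷ π) N∉ =
    All.map⁺ (All.tabulate λ _ eq → N∉ (here (proj₁ (∷-injective eq))))
    ∷ Unique.map⁺ (λ eq → proj₂ (∷-injective eq)) (insertions-unique N π (N∉ ∘ there))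

  ++-∷-injective : ∀ {A : Set} {N : A} u v u′ v′ → N ∉ u → N ∉ u′ →
    u ++ N ∷ v ≡ u′ ++ N ∷ v′ → u ++ v ≡ u′ ++ v′
  ++-∷-injective [] v [] v′ _ _ refl = refl
  ++-∷-injective [] v (x ∷ u′) v′ _ N∉u′ refl = ⊥-elim (N∉u′ (here refl))
  ++-∷-injective (x ∷ u) v [] v′ N∉u _ refl = ⊥-elim (N∉u (here refl))
  ++-∷-injective (x ∷ u) v (y ∷ u′) v′ N∉u N∉u′ eq with ∷-injective eq
  ... | refl , eq′ = cong (x ∷_) (++-∷-injective u v u′ v′ (N∉u ∘ there) (N∉u′ ∘ there) eq′)

  insertions-disjoint : ∀ N π π′ → N ∉ π → N ∉ π′ → π ≢ π′ →
    Disjoint (insertions N π) (insertions N π′)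
  insertions-disjoint N π π′ N∉π N∉π′ π≢π′ (w∈ , w∈′)
    with ∈-insertions⁻ N π w∈ | ∈-insertions⁻ N π′ w∈′
  ... | u , v , refl , refl | u′ , v′ , refl , eq =
    π≢π′ (++-∷-injective u v u′ v′ (N∉π ∘ ∈-++⁺ˡ) (N∉π′ ∘ ∈-++⁺ˡ) eq)

  unique⇒length≤ : ∀ {A : Set} (xs ys : List A) → Unique xs → All (_∈ ys) xs → length xs ≤ length ys
  unique⇒length≤ [] ys _ _ = z≤n
  unique⇒length≤ (x ∷ xs) ys (x∉xs ∷ xs!) (x∈ys ∷ xs⊆ys) with ∈-∃++ x∈ys
  ... | ys₁ , ys₂ , refl = begin
    suc (length xs)
      ≤⟨ s≤s (unique⇒length≤ xs (ys₁ ++ ys₂) xs! (All.zipWith drop (x∉xs , xs⊆ys))) ⟩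
    suc (length (ys₁ ++ ys₂)) ≡⟨ sym (↭-length (shift x ys₁ ys₂)) ⟩
    length (ys₁ ++ x ∷ ys₂)  ∎
    where
    open ≤-Reasoning
    drop : ∀ {z} → x ≢ z × z ∈ ys₁ ++ x ∷ ys₂ → z ∈ ys₁ ++ ys₂
    drop (x≢z , z∈) with ∈-resp-↭ (shift x ys₁ ys₂) z∈
    ... | here z≡x = ⊥-elim (x≢z (sym z≡x))
    ... | there z∈′ = z∈′

  ∈-oneTo⇒≤ : ∀ n {x} → x ∈ oneTo n → x ≤ n
  ∈-oneTo⇒≤ (suc n) x∈ with ∈-++⁻ (oneTo n) x∈
  ... | inj₁ x∈′ = m≤n⇒m≤1+n (∈-oneTo⇒≤ n x∈′)
  ... | inj₂ (here refl) = ≤-refl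

  ∈-oneTo-pred : ∀ n {x} → x ∈ oneTo (suc n) → x ≢ suc n → x ∈ oneTo n
  ∈-oneTo-pred n x∈ x≢ with ∈-++⁻ (oneTo n) x∈
  ... | inj₁ x∈′ = x∈′
  ... | inj₂ (here x≡) = ⊥-elim (x≢ x≡)

  suc∉oneTo : ∀ n → suc n ∉ oneTo n
  suc∉oneTo n N∈ = <-irrefl refl (∈-oneTo⇒≤ n N∈)

  length-oneTo : ∀ n → length (oneTo n) ≡ n
  length-oneTo zero = refl
  length-oneTo (suc n) = trans (length-++ (oneTo n)) (trans (cong (_+ 1) (length-oneTo n)) (+-comm n 1))

  oneTo-unique : ∀ n → Unique (oneTo n)
  oneTo-unique zero = []
  oneTo-unique (suc n) = Unique.++⁺ (oneTo-unique n) ([] ∷ []) λ where (N∈ , here refl) → suc∉oneTo n N∈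

  ∈-words⁻ : ∀ n m {w} → w ∈ words n m → length w ≡ m × All (_∈ oneTo n) w
  ∈-words⁻ n zero (here refl) = refl , []
  ∈-words⁻ n (suc m) w∈ with find (∈-concatMap⁻ (λ a → map (a ∷_) (words n m)) {xs = oneTo n} w∈)
  ... | a , a∈ , w∈′ with ∈-map⁻ (a ∷_) w∈′
  ... | w′ , w′∈ , refl = let (len , letters) = ∈-words⁻ n m w′∈ in cong suc len , a∈ ∷ letters

  ∈-words⁺ : ∀ n m {w} → length w ≡ m → All (_∈ oneTo n) w → w ∈ words n m
  ∈-words⁺ n zero {[]} refl [] = here refl
  ∈-words⁺ n (suc m) {a ∷ w} len (a∈ ∷ letters) =
    ∈-concatMap⁺ (λ a → map (a ∷_) (words n m))
      (lose a∈ (∈-map⁺ (a ∷_) (∈-words⁺ n m (suc-injective len) letters)))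

  words-unique : ∀ n m → Unique (words n m)
  words-unique n zero = [] ∷ []
  words-unique n (suc m) =
    Unique.concat⁺
      (All.map⁺ (All.tabulate λ _ → Unique.map⁺ (λ eq → proj₂ (∷-injective eq)) (words-unique n m)))
      (AllPairs.map⁺ (AllPairs.map disjoint (oneTo-unique n)))
    where
    disjoint : ∀ {a b} → a ≢ b → Disjoint (map (a ∷_) (words n m)) (map (b ∷_) (words n m))
    disjoint a≢b (w∈ , w∈′) with ∈-map⁻ _ w∈ | ∈-map⁻ _ w∈′
    ... | _ , _ , refl | _ , _ , eq = a≢b (proj₁ (∷-injective eq))

  any-≡ᵇ-false : ∀ a w → any (a ≡ᵇ_) w ≡ false ⇔ All (a ≢_) w
  any-≡ᵇ-false a [] = mk⇔ (λ _ → []) (λ _ → refl)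
  any-≡ᵇ-false a (b ∷ w) with a ≡ᵇ b in eq
  ... | true = mk⇔ (λ ()) (λ a∉ → ⊥-elim (All.head a∉ (≡ᵇ⇒≡ a b (Equivalence.from T-≡ eq))))
  ... | false = mk⇔ (λ h → (λ { refl → subst T eq (≡⇒≡ᵇ a a refl) }) ∷ Equivalence.to (any-≡ᵇ-false a w) h)
                    (Equivalence.from (any-≡ᵇ-false a w) ∘ All.tail)

  distinct⇔unique : ∀ w → distinct w ≡ true ⇔ Unique w
  distinct⇔unique [] = mk⇔ (λ _ → []) (λ _ → refl)
  distinct⇔unique (a ∷ w) with any (a ≡ᵇ_) w in eq
  ... | true = mk⇔ (λ ()) λ a∷w! →
    ⊥-elim (subst T (Equivalence.from (any-≡ᵇ-false a w) (AllPairs.head a∷w!)) (Equivalence.from T-≡ eq))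
  ... | false = mk⇔ (λ d → Equivalence.to (any-≡ᵇ-false a w) eq ∷ Equivalence.to (distinct⇔unique w) d)
                    (Equivalence.from (distinct⇔unique w) ∘ AllPairs.tail)

  record IsPermutation (n : ℕ) (π : List ℕ) : Set where
    field
      length≡ : length π ≡ n
      letters : All (_∈ oneTo n) π
      unique : Unique π

  ∈-perms⇔ : ∀ n {π} → π ∈ perms n ⇔ IsPermutation n π
  ∈-perms⇔ n {π} = mk⇔ to from
    where
    to : π ∈ perms n → IsPermutation n π
    to π∈ with ∈-filter⁻ (T? ∘ distinct) π∈
    ... | π∈words , d with ∈-words⁻ n n π∈words
    ... | len , letters = record
      { length≡ = len ; letters = letters ; unique = Equivalence.to (distinct⇔unique π) (Equivalence.to T-≡ d) }
    from : IsPermutation n π → π ∈ perms n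
    from p = ∈-filter⁺ (T? ∘ distinct) (∈-words⁺ n n (IsPermutation.length≡ p) (IsPermutation.letters p))
      (Equivalence.from T-≡ (Equivalence.from (distinct⇔unique π) (IsPermutation.unique p)))

  perms-unique : ∀ n → Unique (perms n)
  perms-unique n = Unique.filter⁺ (T? ∘ distinct) (words-unique n n)

  insertion-isPermutation : ∀ n u v → IsPermutation (suc n) (u ++ suc n ∷ v) ⇔ IsPermutation n (u ++ v)
  insertion-isPermutation n u v = mk⇔ remove insert
    where
    shifted = shift (suc n) u v
    remove : IsPermutation (suc n) (u ++ suc n ∷ v) → IsPermutation n (u ++ v)
    remove p with Unique-resp-↭ (↭⇒↭ₛ shifted) (IsPermutation.unique p)
    ... | N∉ ∷ uv! = record
      { length≡ = suc-injective (trans (sym (↭-length shifted)) (IsPermutation.length≡ p))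
      ; letters = All.tabulate λ x∈ →
          ∈-oneTo-pred n (All.lookup (IsPermutation.letters p) (∈-resp-↭ (↭-sym shifted) (there x∈)))
                         (All.lookup N∉ x∈ ∘ sym)
      ; unique = uv! }
    insert : IsPermutation n (u ++ v) → IsPermutation (suc n) (u ++ suc n ∷ v)
    insert p = record
      { length≡ = trans (↭-length shifted) (cong suc (IsPermutation.length≡ p))
      ; letters = All-resp-↭ (↭-sym shifted)
          (∈-++⁺ʳ (oneTo n) (here refl) ∷ All.map ∈-++⁺ˡ (IsPermutation.letters p))
      ; unique = Unique-resp-↭ (↭⇒↭ₛ (↭-sym shifted))
          (All.map (λ x∈ N≡x → suc∉oneTo n (subst (_∈ oneTo n) (sym N≡x) x∈)) (IsPermutation.letters p)
           ∷ IsPermutation.unique p) }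

  suc∉perm : ∀ n {π} → π ∈ perms n → suc n ∉ π
  suc∉perm n π∈ = suc∉oneTo n ∘ All.lookup (IsPermutation.letters (Equivalence.to (∈-perms⇔ n) π∈))

  insertions-pairwise-disjoint : ∀ N πs → All (N ∉_) πs → AllPairs _≢_ πs →
    AllPairs (λ π π′ → Disjoint (insertions N π) (insertions N π′)) πs
  insertions-pairwise-disjoint N [] [] [] = []
  insertions-pairwise-disjoint N (π ∷ πs) (N∉π ∷ N∉πs) (π≢πs ∷ πs!) =
    All.zipWith (λ (N∉π′ , π≢π′) {w} → insertions-disjoint N π _ N∉π N∉π′ π≢π′ {w}) (N∉πs , π≢πs)
    ∷ insertions-pairwise-disjoint N πs N∉πs πs!

  perms-suc-↭ : ∀ n → perms (suc n) ↭ concatMap (insertions (suc n)) (perms n)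
  perms-suc-↭ n = ∼bag⇒↭ (unique∧set⇒bag (perms-unique (suc n)) concat-unique (mk⇔ to from))
    where
    concat-unique : Unique (concatMap (insertions (suc n)) (perms n))
    concat-unique = Unique.concat⁺
      (All.map⁺ (All.tabulate λ π∈ → insertions-unique (suc n) _ (suc∉perm n π∈)))
      (AllPairs.map⁺ (insertions-pairwise-disjoint (suc n) (perms n) (All.tabulate (suc∉perm n)) (perms-unique n)))
    to : ∀ {w} → w ∈ perms (suc n) → w ∈ concatMap (insertions (suc n)) (perms n)
    to {w} w∈ with Equivalence.to (∈-perms⇔ (suc n)) w∈ | suc n ∈? w
    -- Otherwise the n + 1 distinct letters of w would all lie in [n].
    ... | p | no N∉w = ⊥-elim (<-irrefl refl (begin-strict
      n                    <⟨ n<1+n n ⟩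
      suc n                ≡⟨ sym (IsPermutation.length≡ p) ⟩
      length w             ≤⟨ unique⇒length≤ w (oneTo n) (IsPermutation.unique p) below ⟩
      length (oneTo n)     ≡⟨ length-oneTo n ⟩
      n                    ∎))
      where
      open ≤-Reasoning
      below : All (_∈ oneTo n) w
      below = All.tabulate λ {x} x∈ →
        ∈-oneTo-pred n (All.lookup (IsPermutation.letters p) x∈) λ { refl → N∉w x∈ }
    ... | p | yes N∈w with ∈-∃++ N∈w
    ... | u , v , refl = ∈-concatMap⁺ (insertions (suc n))
      (lose (Equivalence.from (∈-perms⇔ n) (Equivalence.to (insertion-isPermutation n u v) p))
            (∈-insertions⁺ (suc n) u v))
    from : ∀ {w} → w ∈ concatMap (insertions (suc n)) (perms n) → w ∈ perms (suc n)
    from w∈ with find (∈-concatMap⁻ (insertions (suc n)) {xs = perms n} w∈)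
    ... | π , π∈ , w∈ins with ∈-insertions⁻ (suc n) π w∈ins
    ... | u , v , refl , refl = Equivalence.from (∈-perms⇔ (suc n))
      (Equivalence.from (insertion-isPermutation n u v) (Equivalence.to (∈-perms⇔ n) π∈))

  -- Simsun permutations under insertion

  all-++ : ∀ (g : ℕ → Bool) xs ys → all g (xs ++ ys) ≡ all g xs ∧ all g ys
  all-++ g [] ys = refl
  all-++ g (x ∷ xs) ys = trans (cong (g x ∧_) (all-++ g xs ys)) (sym (∧-assoc (g x) _ _))

  restrict-id : ∀ k w → All (_∈ oneTo k) w → restrict k w ≡ w
  restrict-id k w letters =
    filter-all (T? ∘ (_<ᵇ suc k)) (All.map (λ x∈ → <⇒<ᵇ (s≤s (∈-oneTo⇒≤ k x∈))) letters)

  restrict-insertion : ∀ n k u v → k ∈ oneTo n → restrict k (u ++ suc n ∷ v) ≡ restrict k (u ++ v)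
  restrict-insertion n k u v k∈ = begin
    restrict k (u ++ suc n ∷ v)            ≡⟨ filter-++ (T? ∘ (_<ᵇ suc k)) u (suc n ∷ v) ⟩
    restrict k u ++ restrict k (suc n ∷ v) ≡⟨ cong (restrict k u ++_) (filter-reject (T? ∘ (_<ᵇ suc k)) {suc n} large) ⟩
    restrict k u ++ restrict k v           ≡⟨ sym (filter-++ (T? ∘ (_<ᵇ suc k)) u v) ⟩
    restrict k (u ++ v)                    ∎
    where
    open ≡-Reasoning
    large : ¬ T (suc n <ᵇ suc k)
    large = subst T (<ᵇ-false (s≤s (∈-oneTo⇒≤ n k∈)))

  simsun-suc : ∀ n w → All (_∈ oneTo (suc n)) w → simsun (suc n) w ≡ simsun n w ∧ noDoubleDescent w
  simsun-suc n w letters = trans (all-++ (λ k → noDoubleDescent (restrict k w)) (oneTo n) (suc n ∷ []))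
    (cong (simsun n w ∧_) (trans (∧-identityʳ _) (cong noDoubleDescent (restrict-id (suc n) w letters))))

  simsun⇒noDoubleDescent : ∀ n {π} → π ∈ perms (suc n) → simsun (suc n) π ≡ true →
    noDoubleDescent π ≡ true
  simsun⇒noDoubleDescent n {π} π∈ s = ∧-conicalʳ (simsun n π) _ (trans (sym (simsun-suc n π letters)) s)
    where
    letters = IsPermutation.letters (Equivalence.to (∈-perms⇔ (suc n)) π∈)

  simsun-insertion : ∀ n {π w} → π ∈ perms n → w ∈ insertions (suc n) π →
    simsun (suc n) w ≡ simsun n π ∧ noDoubleDescent w
  simsun-insertion n π∈ w∈ with ∈-insertions⁻ (suc n) _ w∈
  ... | u , v , refl , refl = trans (simsun-suc n (u ++ suc n ∷ v) (IsPermutation.letters p))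
    (cong (_∧ noDoubleDescent (u ++ suc n ∷ v))
          (cong and (map-cong-local (All.tabulate λ {k} k∈ →
            cong noDoubleDescent (restrict-insertion n k u v k∈)))))
    where
    p = Equivalence.from (insertion-isPermutation n u v) (Equivalence.to (∈-perms⇔ n) π∈)

  -- Peaks of the insertions of a new maximum

  peak : ℕ → ℕ → ℕ → ℕ
  peak a b c = if (a <ᵇ b) ∧ (c <ᵇ b) then 1 else 0

  secondPeak : List ℕ → ℕ
  secondPeak (a ∷ b ∷ c ∷ _) = peak a b c
  secondPeak _ = 0

  pk-∷∷ : ∀ a b r → secondPeak (a ∷ b ∷ r) + pk (b ∷ r) ≡ pk (a ∷ b ∷ r)
  pk-∷∷ a b [] = refl
  pk-∷∷ a b (c ∷ r) = refl

  noDoubleDescent-tail : ∀ a w → noDoubleDescent (a ∷ w) ≡ true → noDoubleDescent w ≡ true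
  noDoubleDescent-tail a [] _ = refl
  noDoubleDescent-tail a (b ∷ []) _ = refl
  noDoubleDescent-tail a (b ∷ c ∷ w) nd = ∧-conicalʳ _ _ nd

  not-∧⇒false : ∀ {x y} → x ≡ true → not (x ∧ y) ≡ true → y ≡ false
  not-∧⇒false {y = false} refl _ = refl

  noDoubleDescent-head : ∀ a b c w → noDoubleDescent (a ∷ b ∷ c ∷ w) ≡ true →
    not ((b <ᵇ a) ∧ (c <ᵇ b)) ≡ true
  noDoubleDescent-head a b c w nd = ∧-conicalˡ _ _ nd

  score : (List ℕ → Bool) → (ℕ → ℕ) → List ℕ → ℕ
  score S f w = if S w ∧ noDoubleDescent w then f (pk w) else 0

  weight : (List ℕ → Bool) → (ℕ → ℕ) → List (List ℕ) → ℕ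
  weight S f ws = sum (map (score S f) ws)

  -- g counts p + 1 words with p peaks and B words with p + 1 peaks (g f sums f over the peak numbers).
  PeakCounts : ((ℕ → ℕ) → ℕ) → ℕ → ℕ → Set
  PeakCounts g p B = ∀ f → g f ≡ (p + 1) * f p + B * f (suc p)

  weight-shift : ∀ {a b c} (f : ℕ → ℕ) → not ((b <ᵇ a) ∧ (c <ᵇ b)) ≡ true → ∀ ts →
    weight (const true) f (map (λ t → a ∷ b ∷ c ∷ t) ts)
      ≡ weight (const true) (λ j → f (peak a b c + j)) (map (λ t → b ∷ c ∷ t) ts)
  weight-shift f h [] = refl
  weight-shift {a} {b} {c} f h (t ∷ ts) = cong₂ _+_
    (cong (λ s → if s ∧ noDoubleDescent (b ∷ c ∷ t) then f (peak a b c + pk (b ∷ c ∷ t)) else 0) h)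
    (weight-shift f h ts)

  weight-accepted : ∀ S {a b} (f : ℕ → ℕ) → (∀ t → S (a ∷ b ∷ t) ≡ true) → ∀ ts →
    weight S f (map (λ t → a ∷ b ∷ t) ts) ≡ weight (const true) f (map (λ t → a ∷ b ∷ t) ts)
  weight-accepted S f h [] = refl
  weight-accepted S {a} {b} f h (t ∷ ts) = cong₂ _+_
    (cong (λ s → if s ∧ noDoubleDescent (a ∷ b ∷ t) then f (pk (a ∷ b ∷ t)) else 0) (h t))
    (weight-accepted S f h ts)

  weight-rejected : ∀ S {a b} (f : ℕ → ℕ) → (∀ t → S (a ∷ b ∷ t) ≡ false) → ∀ ts →
    weight S f (map (λ t → a ∷ b ∷ t) ts) ≡ 0
  weight-rejected S f h [] = refl
  weight-rejected S {a} {b} f h (t ∷ ts) = cong₂ _+_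
    (cong (λ s → if s ∧ noDoubleDescent (a ∷ b ∷ t) then f (pk (a ∷ b ∷ t)) else 0) (h t))
    (weight-rejected S f h ts)

  -- Shape x y v records, for a word a b c …, whether b is a peak (x), whether c is a peak (y) and
  -- whether c is followed by a descent (v); without double descents only these three combinations occur.
  data Shape : ℕ → ℕ → Bool → Set where
    neither : Shape 0 0 false
    peakAtNext : Shape 0 1 true
    peakHere : Shape 1 0 false

  shape : ∀ a b c r → noDoubleDescent (b ∷ c ∷ r) ≡ true → b ≢ c →
    Shape (peak a b c) (secondPeak (b ∷ c ∷ r)) (startsDescent (c ∷ r))
  shape a b c [] _ _ with (a <ᵇ b) ∧ (c <ᵇ b)
  ... | true = peakHere
  ... | false = neither
  shape a b c (d ∷ r) nd b≢c with c <ᵇ b in cb | d <ᵇ c | noDoubleDescent-head b c d r nd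
  ... | true | true | ()
  ... | true | false | _ rewrite ∧-zeroʳ (b <ᵇ c) with a <ᵇ b
  ...   | true = peakHere
  ...   | false = neither
  shape a b c (d ∷ r) nd b≢c | false | false | _ rewrite ∧-zeroʳ (a <ᵇ b) | ∧-zeroʳ (b <ᵇ c) = neither
  shape a b c (d ∷ r) nd b≢c | false | true | _ rewrite ∧-zeroʳ (a <ᵇ b) | <ᵇ-swap b≢c cb = peakAtNext

  shape-ascent : ∀ a b r → a < b → Shape 0 (secondPeak (a ∷ b ∷ r)) (startsDescent (b ∷ r))
  shape-ascent a b [] _ = neither
  shape-ascent a b (c ∷ r) a<b rewrite <ᵇ-true a<b with c <ᵇ b
  ... | true = peakAtNext
  ... | false = neither

  descent-start : ∀ a b r → b < a → noDoubleDescent (a ∷ b ∷ r) ≡ true →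
    secondPeak (a ∷ b ∷ r) ≡ 0 × startsDescent (b ∷ r) ≡ false
  descent-start a b [] _ _ = refl , refl
  descent-start a b (c ∷ r) b<a nd =
    cong (λ x → if x ∧ (c <ᵇ b) then 1 else 0) (<ᵇ-reverse b<a) ,
    not-∧⇒false (<ᵇ-true b<a) (noDoubleDescent-head a b c r nd)

  -- Below, g weighs the insertions into a b c … after b and h those into b c … after c. The extra summand is
  -- the insertion between b and c: admissible unless c starts a descent, and then the new letter is a peak while
  -- b no longer is one; the later insertions keep b's status, hence the shift by x.
  counts-step : ∀ {x y v X p B′ L} {g h : (ℕ → ℕ) → ℕ} → Shape x y v → y + X ≡ p →
    B′ + 2 * p + 2 ≡ L + y → PeakCounts h p B′ →
    (∀ f → g f ≡ (if v then 0 else f (suc X)) + h (λ j → f (x + j))) →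
    ∃[ B ] B + 2 * (x + p) + 2 ≡ suc L + x × PeakCounts g (x + p) B
  counts-step {X = X} {B′ = B′} neither refl inv hc gc =
    suc B′ , cong suc inv ,
    λ f → trans (gc f) (trans (cong (f (suc X) +_) (hc f)) (arith X B′ (f (suc X)) (f X)))
    where
    arith : ∀ X B y x → y + ((X + 1) * x + B * y) ≡ (X + 1) * x + suc B * y
    arith = solve-∀
  counts-step {L = L} peakAtNext refl inv hc gc = _ , trans inv (arith L) , λ f → trans (gc f) (hc f)
    where
    arith : ∀ L → L + 1 ≡ suc L + 0
    arith = solve-∀
  counts-step {X = X} {B′ = B′} {L} peakHere refl inv hc gc =
    B′ , invariant , λ f → trans (gc f) (trans (cong (f (suc X) +_) (hc (λ j → f (suc j))))
                                                 (arith X B′ (f (suc X)) (f (suc (suc X)))))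
    where
    arith : ∀ X B y z → y + ((X + 1) * y + B * z) ≡ (suc X + 1) * y + B * z
    arith = solve-∀
    invariant : B′ + 2 * suc X + 2 ≡ suc L + 1
    invariant = trans (regroup B′ X) (trans (cong (_+ 2) inv) (regroup′ L))
      where
      regroup : ∀ B X → B + 2 * suc X + 2 ≡ B + 2 * X + 2 + 2
      regroup = solve-∀
      regroup′ : ∀ L → L + 0 + 2 ≡ suc L + 1
      regroup′ = solve-∀

  module _ (N : ℕ) where

    laterWeight : (ℕ → ℕ) → ℕ → ℕ → List ℕ → ℕ
    laterWeight f a b r = weight (const true) f (map (λ t → a ∷ b ∷ t) (insertions N r))

    laterWeight-∷ : ∀ f a b c r → not ((b <ᵇ a) ∧ (c <ᵇ b)) ≡ true →
      laterWeight f a b (c ∷ r)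
        ≡ score (const true) f (a ∷ b ∷ N ∷ c ∷ r) + laterWeight (λ j → f (peak a b c + j)) b c r
    laterWeight-∷ f a b c r h = cong (score (const true) f (a ∷ b ∷ N ∷ c ∷ r) +_) (begin
      weight (const true) f (map (λ t → a ∷ b ∷ t) (map (c ∷_) (insertions N r)))
        ≡⟨ cong (weight (const true) f) (sym (map-∘ (insertions N r))) ⟩
      weight (const true) f (map (λ t → a ∷ b ∷ c ∷ t) (insertions N r))
        ≡⟨ weight-shift f h (insertions N r) ⟩
      laterWeight (λ j → f (peak a b c + j)) b c r ∎)
      where open ≡-Reasoning

    score-third : ∀ f a b c r → b < N → c < N → noDoubleDescent (c ∷ r) ≡ true →
      score (const true) f (a ∷ b ∷ N ∷ c ∷ r)
        ≡ (if startsDescent (c ∷ r) then 0 else f (suc (pk (c ∷ r))))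
    score-third f a b c [] b<N c<N _
      rewrite <ᵇ-reverse b<N | ∧-zeroʳ (b <ᵇ a) | ∧-zeroʳ (a <ᵇ b) | <ᵇ-true b<N | <ᵇ-true c<N = refl
    score-third f a b c (d ∷ r) b<N c<N nd
      rewrite <ᵇ-reverse b<N | ∧-zeroʳ (b <ᵇ a) | ∧-zeroʳ (a <ᵇ b) | <ᵇ-true b<N | <ᵇ-true c<N
            | <ᵇ-reverse c<N | nd with d <ᵇ c
    ... | true = refl
    ... | false = refl

    laterWeight-end : ∀ a b → b < N → PeakCounts (λ f → laterWeight f a b []) 0 0
    laterWeight-end a b b<N f
      rewrite <ᵇ-reverse b<N | ∧-zeroʳ (b <ᵇ a) | ∧-zeroʳ (a <ᵇ b) = sym (+-identityʳ _)

    laterWeight-counts : ∀ a b r → All (_< N) (a ∷ b ∷ r) → noDoubleDescent (a ∷ b ∷ r) ≡ true →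
      Linked _≢_ (b ∷ r) →
      ∃[ B ] B + 2 * pk (a ∷ b ∷ r) + 2 ≡ length (a ∷ b ∷ r) + secondPeak (a ∷ b ∷ r)
           × PeakCounts (λ f → laterWeight f a b r) (pk (a ∷ b ∷ r)) B
    laterWeight-counts a b [] (_ ∷ b<N ∷ []) _ _ = 0 , refl , laterWeight-end a b b<N
    laterWeight-counts a b (c ∷ r) (_ ∷ b<N ∷ c<N ∷ r<N) nd (b≢c ∷ bcr)
      with laterWeight-counts b c r (b<N ∷ c<N ∷ r<N) (noDoubleDescent-tail a (b ∷ c ∷ r) nd) bcr
    ... | B′ , inv , counts =
      counts-step {B′ = B′} {L = length (b ∷ c ∷ r)}
                  {g = λ f → laterWeight f a b (c ∷ r)} {h = λ f → laterWeight f b c r}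
        (shape a b c r nd′ b≢c) (pk-∷∷ b c r) inv counts λ f →
        trans (laterWeight-∷ f a b c r (noDoubleDescent-head a b c r nd))
              (cong (_+ laterWeight (λ j → f (peak a b c + j)) b c r)
                    (score-third f a b c r b<N c<N (noDoubleDescent-tail b (c ∷ r) nd′)))
      where
      nd′ : noDoubleDescent (b ∷ c ∷ r) ≡ true
      nd′ = noDoubleDescent-tail a (b ∷ c ∷ r) nd

    weight-insertions : ∀ S f a b r → weight S f (insertions N (a ∷ b ∷ r))
      ≡ score S f (N ∷ a ∷ b ∷ r)
        + (score S f (a ∷ N ∷ b ∷ r) + weight S f (map (λ t → a ∷ b ∷ t) (insertions N r)))
    weight-insertions S f a b r =
      cong (λ ws → score S f (N ∷ a ∷ b ∷ r) + (score S f (a ∷ N ∷ b ∷ r) + weight S f ws))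
           (sym (map-∘ (insertions N r)))

    score-first-descent : ∀ f a b r → a < N → noDoubleDescent (a ∷ b ∷ r) ≡ true →
      score startsDescent f (N ∷ a ∷ b ∷ r) ≡ (if b <ᵇ a then 0 else f (pk (a ∷ b ∷ r)))
    score-first-descent f a b r a<N nd rewrite <ᵇ-true a<N | <ᵇ-reverse a<N | nd with b <ᵇ a
    ... | true = refl
    ... | false = refl

    score-first-ascent : ∀ f a b r → a < N → score startsAscent f (N ∷ a ∷ b ∷ r) ≡ 0
    score-first-ascent f a b r a<N rewrite <ᵇ-reverse a<N = refl

    score-second-descent : ∀ f a b r → a < N → score startsDescent f (a ∷ N ∷ b ∷ r) ≡ 0
    score-second-descent f a b r a<N rewrite <ᵇ-reverse a<N = refl

    score-second-ascent : ∀ f a b r → a < N → b < N → noDoubleDescent (b ∷ r) ≡ true →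
      score startsAscent f (a ∷ N ∷ b ∷ r) ≡ (if startsDescent (b ∷ r) then 0 else f (suc (pk (b ∷ r))))
    score-second-ascent f a b [] a<N b<N _ rewrite <ᵇ-true a<N | <ᵇ-true b<N | <ᵇ-reverse a<N = refl
    score-second-ascent f a b (c ∷ r) a<N b<N nd
      rewrite <ᵇ-true a<N | <ᵇ-true b<N | <ᵇ-reverse a<N | <ᵇ-reverse b<N | nd with c <ᵇ b
    ... | true = refl
    ... | false = refl

    descent-start-classes : ∀ a b r → b < a → All (_< N) (a ∷ b ∷ r) →
      noDoubleDescent (a ∷ b ∷ r) ≡ true →
      (∀ f → weight startsDescent f (insertions N (a ∷ b ∷ r)) ≡ laterWeight f a b r)
      × (∀ f → weight startsAscent f (insertions N (a ∷ b ∷ r)) ≡ f (suc (pk (a ∷ b ∷ r))))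
    descent-start-classes a b r b<a (a<N ∷ b<N ∷ _) nd = descentClass , ascentClass
      where
      open ≡-Reasoning
      descentClass : ∀ f → weight startsDescent f (insertions N (a ∷ b ∷ r)) ≡ laterWeight f a b r
      descentClass f = trans (weight-insertions startsDescent f a b r)
        (cong₂ _+_ (trans (score-first-descent f a b r a<N nd)
                          (cong (λ s → if s then 0 else f (pk (a ∷ b ∷ r))) (<ᵇ-true b<a)))
                   (cong₂ _+_ (score-second-descent f a b r a<N)
                              (weight-accepted startsDescent f (λ _ → <ᵇ-true b<a) (insertions N r))))
      ascentClass : ∀ f → weight startsAscent f (insertions N (a ∷ b ∷ r)) ≡ f (suc (pk (a ∷ b ∷ r)))
      ascentClass f with descent-start a b r b<a nd
      ... | noPeak , noDescent = begin
        weight startsAscent f (insertions N (a ∷ b ∷ r))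
          ≡⟨ weight-insertions startsAscent f a b r ⟩
        score startsAscent f (N ∷ a ∷ b ∷ r) + (score startsAscent f (a ∷ N ∷ b ∷ r)
          + weight startsAscent f (map (λ t → a ∷ b ∷ t) (insertions N r)))
          ≡⟨ cong₂ _+_ (score-first-ascent f a b r a<N)
                       (cong₂ _+_ (score-second-ascent f a b r a<N b<N (noDoubleDescent-tail a (b ∷ r) nd))
                                  (weight-rejected startsAscent f (λ _ → <ᵇ-reverse b<a) (insertions N r))) ⟩
        (if startsDescent (b ∷ r) then 0 else f (suc (pk (b ∷ r)))) + 0
          ≡⟨ trans (+-identityʳ _) (cong (λ s → if s then 0 else f (suc (pk (b ∷ r)))) noDescent) ⟩
        f (suc (pk (b ∷ r)))
          ≡⟨ cong (λ x → f (suc (x + pk (b ∷ r)))) (sym noPeak) ⟩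
        f (suc (secondPeak (a ∷ b ∷ r) + pk (b ∷ r)))
          ≡⟨ cong (λ p → f (suc p)) (pk-∷∷ a b r) ⟩
        f (suc (pk (a ∷ b ∷ r))) ∎

    ascent-start-classes : ∀ a b r → a < b → All (_< N) (a ∷ b ∷ r) →
      noDoubleDescent (a ∷ b ∷ r) ≡ true →
      (∀ f → weight startsDescent f (insertions N (a ∷ b ∷ r)) ≡ f (pk (a ∷ b ∷ r)))
      × (∀ f → weight startsAscent f (insertions N (a ∷ b ∷ r))
               ≡ (if startsDescent (b ∷ r) then 0 else f (suc (pk (b ∷ r)))) + laterWeight f a b r)
    ascent-start-classes a b r a<b (a<N ∷ b<N ∷ _) nd = descentClass , ascentClass
      where
      descentClass : ∀ f → weight startsDescent f (insertions N (a ∷ b ∷ r)) ≡ f (pk (a ∷ b ∷ r))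
      descentClass f = trans (weight-insertions startsDescent f a b r)
        (trans (cong₂ _+_ (trans (score-first-descent f a b r a<N nd)
                                 (cong (λ s → if s then 0 else f (pk (a ∷ b ∷ r))) (<ᵇ-reverse a<b)))
                          (cong₂ _+_ (score-second-descent f a b r a<N)
                                     (weight-rejected startsDescent f (λ _ → <ᵇ-reverse a<b) (insertions N r))))
               (+-identityʳ _))
      ascentClass : ∀ f → weight startsAscent f (insertions N (a ∷ b ∷ r))
        ≡ (if startsDescent (b ∷ r) then 0 else f (suc (pk (b ∷ r)))) + laterWeight f a b r
      ascentClass f = trans (weight-insertions startsAscent f a b r)
        (cong₂ _+_ (score-first-ascent f a b r a<N)
                   (cong₂ _+_ (score-second-ascent f a b r a<N b<N (noDoubleDescent-tail a (b ∷ r) nd))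
                              (weight-accepted startsAscent f (λ _ → <ᵇ-true a<b) (insertions N r))))

    descent-counts : ∀ a b r → b < a → All (_< N) (a ∷ b ∷ r) → noDoubleDescent (a ∷ b ∷ r) ≡ true →
      Linked _≢_ (b ∷ r) →
      ∃[ C ] C + 2 * pk (a ∷ b ∷ r) + 2 ≡ length (a ∷ b ∷ r)
           × PeakCounts (λ f → weight startsDescent f (insertions N (a ∷ b ∷ r))) (pk (a ∷ b ∷ r)) C
           × (∀ f → weight startsAscent f (insertions N (a ∷ b ∷ r)) ≡ f (suc (pk (a ∷ b ∷ r))))
    descent-counts a b r b<a letters nd br =
      let C , inv , counts = laterWeight-counts a b r letters nd br
          descentClass , ascentClass = descent-start-classes a b r b<a letters nd
          noPeak , _ = descent-start a b r b<a nd
      in C , trans inv (trans (cong (length (a ∷ b ∷ r) +_) noPeak) (+-identityʳ _)) ,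
         (λ f → trans (descentClass f) (counts f)) , ascentClass

    ascent-counts : ∀ a b r → a < b → All (_< N) (a ∷ b ∷ r) → noDoubleDescent (a ∷ b ∷ r) ≡ true →
      Linked _≢_ (b ∷ r) →
      ∃[ C ] C + 2 * pk (a ∷ b ∷ r) + 2 ≡ suc (length (a ∷ b ∷ r))
           × (∀ f → weight startsDescent f (insertions N (a ∷ b ∷ r)) ≡ f (pk (a ∷ b ∷ r)))
           × PeakCounts (λ f → weight startsAscent f (insertions N (a ∷ b ∷ r))) (pk (a ∷ b ∷ r)) C
    ascent-counts a b r a<b letters nd br =
      let B , inv , counts = laterWeight-counts a b r letters nd br
          descentClass , ascentClass = ascent-start-classes a b r a<b letters nd
          C , inv′ , ascentCounts =
            counts-step {B′ = B} {L = length (a ∷ b ∷ r)} {g = λ f → weight startsAscent f (insertions N (a ∷ b ∷ r))}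
                        {h = λ f → laterWeight f a b r} (shape-ascent a b r a<b) (pk-∷∷ a b r) inv counts ascentClass
      in C , trans inv′ (+-identityʳ _) , descentClass , ascentCounts

  -- Summing over permutations

  χ : Bool → ℕ
  χ b = if b then 1 else 0

  δ : ℕ → ℕ → ℕ
  δ k j = χ (j ≡ᵇ k)

  ≡ᵇ-suc : ∀ k → (suc k ≡ᵇ k) ≡ false
  ≡ᵇ-suc zero = refl
  ≡ᵇ-suc (suc k) = ≡ᵇ-suc k

  -- x = (k + 1) a + (m − 2k) y + b, with 2k y moved to the left to avoid truncated subtraction.
  record Recurrence (k m x a y b : ℕ) : Set where
    constructor recurrence
    field
      identity : x + 2 * k * y ≡ (k + 1) * a + m * y + b

  recurrence-only-last : ∀ k m x → Recurrence k m x 0 0 x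
  recurrence-only-last k m x = recurrence (arith k m x)
    where
    arith : ∀ k m x → x + 2 * k * 0 ≡ (k + 1) * 0 + m * 0 + x
    arith = solve-∀

  recurrence-δ : ∀ k p C m → C + 2 * p + 2 ≡ m →
    Recurrence k m ((p + 1) * δ k p + C * δ k (suc p)) (δ k p) (δ k (suc p)) 0
  recurrence-δ k p C m inv with p ≡ᵇ k in p≡k
  ... | true rewrite ≡ᵇ⇒≡ p k (Equivalence.from T-≡ p≡k) | ≡ᵇ-suc k = recurrence (arith k C m)
    where
    arith : ∀ k C m → (k + 1) * 1 + C * 0 + 2 * k * 0 ≡ (k + 1) * 1 + m * 0 + 0
    arith = solve-∀
  ... | false with suc p ≡ᵇ k in sp≡k
  ...   | false = recurrence (arith p C k m)
    where
    arith : ∀ p C k m → (p + 1) * 0 + C * 0 + 2 * k * 0 ≡ (k + 1) * 0 + m * 0 + 0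
    arith = solve-∀
  ...   | true rewrite sym (≡ᵇ⇒≡ (suc p) k (Equivalence.from T-≡ sp≡k)) | sym inv = recurrence (arith p C)
    where
    arith : ∀ p C → (p + 1) * 0 + C * 1 + 2 * suc p * 1 ≡ (suc p + 1) * 0 + (C + 2 * p + 2) * 1 + 0
    arith = solve-∀

  recurrence-sum : ∀ {A : Set} k m (x a y b : A → ℕ) xs →
    (∀ π → π ∈ xs → Recurrence k m (x π) (a π) (y π) (b π)) →
    Recurrence k m (sum (map x xs)) (sum (map a xs)) (sum (map y xs)) (sum (map b xs))
  recurrence-sum k m x a y b [] _ = recurrence-only-last k m 0
  recurrence-sum k m x a y b (π ∷ πs) rec = recurrence (begin
    x π + X + 2 * k * (y π + Y)                     ≡⟨ regroup (x π) X k (y π) Y ⟩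
    (x π + 2 * k * y π) + (X + 2 * k * Y)
      ≡⟨ cong₂ _+_ (Recurrence.identity (rec π (here refl)))
                   (Recurrence.identity (recurrence-sum k m x a y b πs (λ π′ → rec π′ ∘ there))) ⟩
    ((k + 1) * a π + m * y π + b π) + ((k + 1) * A′ + m * Y + B)
                                                    ≡⟨ regroup′ k (a π) A′ m (y π) Y (b π) B ⟩
    (k + 1) * (a π + A′) + m * (y π + Y) + (b π + B) ∎)
    where
    open ≡-Reasoning
    X = sum (map x πs)
    A′ = sum (map a πs)
    Y = sum (map y πs)
    B = sum (map b πs)
    regroup : ∀ x X k y Y → x + X + 2 * k * (y + Y) ≡ (x + 2 * k * y) + (X + 2 * k * Y)
    regroup = solve-∀
    regroup′ : ∀ k a A m y Y b B → ((k + 1) * a + m * y + b) + ((k + 1) * A + m * Y + B)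
                                   ≡ (k + 1) * (a + A) + m * (y + Y) + (b + B)
    regroup′ = solve-∀

  Recurrence-cong : ∀ {k m x x′ a a′ y y′ b b′} → x ≡ x′ → a ≡ a′ → y ≡ y′ → b ≡ b′ →
    Recurrence k m x a y b → Recurrence k m x′ a′ y′ b′
  Recurrence-cong refl refl refl refl r = r

  χ-∧-subst : ∀ {s t x} → s ≡ t → χ (t ∧ x) ≡ χ (s ∧ x)
  χ-∧-subst refl = refl

  -- σ is the simsun test of π: when it fails, π contributes nothing and every term vanishes.
  InsertionRecurrences : ℕ → ℕ → Bool → List ℕ → Set
  InsertionRecurrences n k σ π =
    Recurrence k n (if σ then weight startsDescent (δ k) (insertions (suc n) π) else 0)
      (χ (σ ∧ startsDescent π ∧ (pk π ≡ᵇ k))) (χ (σ ∧ startsDescent π ∧ (suc (pk π) ≡ᵇ k)))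
      (χ (σ ∧ startsAscent π ∧ (pk π ≡ᵇ k)))
    × Recurrence k (suc n) (if σ then weight startsAscent (δ k) (insertions (suc n) π) else 0)
      (χ (σ ∧ startsAscent π ∧ (pk π ≡ᵇ k))) (χ (σ ∧ startsAscent π ∧ (suc (pk π) ≡ᵇ k)))
      (χ (σ ∧ startsDescent π ∧ (suc (pk π) ≡ᵇ k)))

  insertion-recurrences : ∀ n k a b r σ → All (_< suc n) (a ∷ b ∷ r) → Linked _≢_ (a ∷ b ∷ r) →
    length (a ∷ b ∷ r) ≡ n → (σ ≡ true → noDoubleDescent (a ∷ b ∷ r) ≡ true) →
    InsertionRecurrences n k σ (a ∷ b ∷ r)
  insertion-recurrences n k a b r false _ _ _ _ = recurrence-only-last k n 0 , recurrence-only-last k (suc n) 0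
  insertion-recurrences n k a b r true letters (a≢b ∷ br) len nd = by-order (<-cmp a b)
    where
    p = pk (a ∷ b ∷ r)
    by-order : Tri (a < b) (a ≡ b) (b < a) → InsertionRecurrences n k true (a ∷ b ∷ r)
    by-order (tri≈ _ a≡b _) = ⊥-elim (a≢b a≡b)
    by-order (tri> _ _ b<a) =
      let C , inv , descentClass , ascentClass = descent-counts (suc n) a b r b<a letters (nd refl) br in
      Recurrence-cong (sym (descentClass (δ k)))
        (χ-∧-subst (<ᵇ-true b<a)) (χ-∧-subst (<ᵇ-true b<a)) (χ-∧-subst (<ᵇ-reverse b<a))
        (recurrence-δ k p C n (trans inv len)) ,
      Recurrence-cong (sym (ascentClass (δ k)))
        (χ-∧-subst (<ᵇ-reverse b<a)) (χ-∧-subst (<ᵇ-reverse b<a)) (χ-∧-subst (<ᵇ-true b<a))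
        (recurrence-only-last k (suc n) (δ k (suc p)))
    by-order (tri< a<b _ _) =
      let C , inv , descentClass , ascentClass = ascent-counts (suc n) a b r a<b letters (nd refl) br in
      Recurrence-cong (sym (descentClass (δ k)))
        (χ-∧-subst (<ᵇ-reverse a<b)) (χ-∧-subst (<ᵇ-reverse a<b)) (χ-∧-subst (<ᵇ-true a<b))
        (recurrence-only-last k n (δ k p)) ,
      Recurrence-cong (sym (ascentClass (δ k)))
        (χ-∧-subst (<ᵇ-true a<b)) (χ-∧-subst (<ᵇ-true a<b)) (χ-∧-subst (<ᵇ-reverse a<b))
        (recurrence-δ k p C (suc n) (trans inv (cong suc len)))

  count : (List ℕ → Bool) → List (List ℕ) → ℕ
  count p xs = length (filterᵇ p xs)

  count≡sum : ∀ p xs → count p xs ≡ sum (map (χ ∘ p) xs)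
  count≡sum p [] = refl
  count≡sum p (x ∷ xs) with p x
  ... | true = cong suc (count≡sum p xs)
  ... | false = count≡sum p xs

  count-concatMap : ∀ p (f : List ℕ → List (List ℕ)) xs →
    count p (concatMap f xs) ≡ sum (map (count p ∘ f) xs)
  count-concatMap p f [] = refl
  count-concatMap p f (x ∷ xs) = begin
    length (filterᵇ p (f x ++ concatMap f xs))             ≡⟨ cong length (filter-++ (T? ∘ p) (f x) _) ⟩
    length (filterᵇ p (f x) ++ filterᵇ p (concatMap f xs)) ≡⟨ length-++ (filterᵇ p (f x)) ⟩
    count p (f x) + count p (concatMap f xs)               ≡⟨ cong (count p (f x) +_) (count-concatMap p f xs) ⟩
    count p (f x) + sum (map (count p ∘ f) xs)             ∎
    where open ≡-Reasoning

  count-perms-suc : ∀ n p → count p (perms (suc n)) ≡ sum (map (count p ∘ insertions (suc n)) (perms n))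
  count-perms-suc n p =
    trans (↭-length (filter-↭ (T? ∘ p) (perms-suc-↭ n))) (count-concatMap p (insertions (suc n)) (perms n))

  simsunWith : ℕ → (List ℕ → Bool) → (ℕ → Bool) → List ℕ → Bool
  simsunWith n S K π = simsun n π ∧ S π ∧ K (pk π)

  countPred : ℕ → (List ℕ → Bool) → ℕ → ℕ
  countPred n S k = count (simsunWith n S (λ j → suc j ≡ᵇ k)) (perms n)

  χ-gated : ∀ σ d s b → χ ((σ ∧ d) ∧ s ∧ b) ≡ (if σ then (if s ∧ d then χ b else 0) else 0)
  χ-gated false d s b = refl
  χ-gated true false false b = refl
  χ-gated true false true b = refl
  χ-gated true true false b = refl
  χ-gated true true true b = refl

  sum-gated : ∀ {A : Set} σ (g : A → ℕ) xs →
    sum (map (λ x → if σ then g x else 0) xs) ≡ (if σ then sum (map g xs) else 0)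
  sum-gated true g xs = refl
  sum-gated false g [] = refl
  sum-gated false g (x ∷ xs) = sum-gated false g xs

  count-insertions : ∀ n S K {π} → π ∈ perms n →
    count (simsunWith (suc n) S K) (insertions (suc n) π)
      ≡ (if simsun n π then weight S (χ ∘ K) (insertions (suc n) π) else 0)
  count-insertions n S K {π} π∈ =
    trans (count≡sum (simsunWith (suc n) S K) (insertions (suc n) π))
          (trans (cong sum (map-cong-local (All.tabulate gated)))
                 (sum-gated (simsun n π) (score S (χ ∘ K)) (insertions (suc n) π)))
    where
    gated : ∀ {w} → w ∈ insertions (suc n) π →
      χ (simsunWith (suc n) S K w) ≡ (if simsun n π then score S (χ ∘ K) w else 0)
    gated {w} w∈ = trans (cong (λ s → χ (s ∧ S w ∧ K (pk w))) (simsun-insertion n π∈ w∈))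
                         (χ-gated (simsun n π) (noDoubleDescent w) (S w) (K (pk w)))

  perm-recurrences : ∀ n k {π} → 2 ≤ n → π ∈ perms n → InsertionRecurrences n k (simsun n π) π
  perm-recurrences n@(suc (suc _)) k {[]} (s≤s (s≤s z≤n)) π∈
    with () ← IsPermutation.length≡ (Equivalence.to (∈-perms⇔ n) π∈)
  perm-recurrences n@(suc (suc _)) k {_ ∷ []} (s≤s (s≤s z≤n)) π∈
    with () ← IsPermutation.length≡ (Equivalence.to (∈-perms⇔ n) π∈)
  perm-recurrences n@(suc (suc m)) k {a ∷ b ∷ r} (s≤s (s≤s z≤n)) π∈ =
    insertion-recurrences n k a b r (simsun n (a ∷ b ∷ r))
      (All.map (λ x∈ → s≤s (∈-oneTo⇒≤ n x∈)) (IsPermutation.letters p))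
      (AllPairs⇒Linked (IsPermutation.unique p))
      (IsPermutation.length≡ p) (simsun⇒noDoubleDescent (suc m) π∈)
    where
    p = Equivalence.to (∈-perms⇔ n) π∈

  recurrence-by-insertion : ∀ n k m S (a y b : List ℕ → Bool) →
    (∀ {π} → π ∈ perms n →
      Recurrence k m (if simsun n π then weight S (δ k) (insertions (suc n) π) else 0)
                     (χ (a π)) (χ (y π)) (χ (b π))) →
    Recurrence k m (count (simsunWith (suc n) S (_≡ᵇ k)) (perms (suc n)))
                   (count a (perms n)) (count y (perms n)) (count b (perms n))
  recurrence-by-insertion n k m S a y b rec =
    Recurrence-cong (sym (trans (count-perms-suc n (simsunWith (suc n) S (_≡ᵇ k)))
                                (cong sum (map-cong-local (All.tabulate (count-insertions n S (_≡ᵇ k)))))))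
                    (sym (count≡sum a (perms n))) (sym (count≡sum y (perms n))) (sym (count≡sum b (perms n)))
                    (recurrence-sum k m _ (χ ∘ a) (χ ∘ y) (χ ∘ b) (perms n) (λ _ → rec))

  recurrence⁺ : ∀ n k → 2 ≤ n →
    Recurrence k n (P⁺ℕ (suc n) k) (P⁺ℕ n k) (countPred n startsDescent k) (P⁻ℕ n k)
  recurrence⁺ n k 2≤n = recurrence-by-insertion n k n startsDescent
    (simsunWith n startsDescent (_≡ᵇ k)) (simsunWith n startsDescent (λ j → suc j ≡ᵇ k))
    (simsunWith n startsAscent (_≡ᵇ k))
    (proj₁ ∘ perm-recurrences n k 2≤n)

  recurrence⁻ : ∀ n k → 2 ≤ n →
    Recurrence k (suc n) (P⁻ℕ (suc n) k) (P⁻ℕ n k) (countPred n startsAscent k) (countPred n startsDescent k)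
  recurrence⁻ n k 2≤n = recurrence-by-insertion n k (suc n) startsAscent
    (simsunWith n startsAscent (_≡ᵇ k)) (simsunWith n startsAscent (λ j → suc j ≡ᵇ k))
    (simsunWith n startsDescent (λ j → suc j ≡ᵇ k))
    (proj₂ ∘ perm-recurrences n k 2≤n)

  no-negative-peaks : ∀ n S → countPred n S 0 ≡ 0
  no-negative-peaks n S = trans (count≡sum _ (perms n)) (none (perms n))
    where
    none : ∀ πs → sum (map (χ ∘ simsunWith n S (λ j → suc j ≡ᵇ 0)) πs) ≡ 0
    none [] = refl
    none (π ∷ πs) rewrite ∧-zeroʳ (S π) | ∧-zeroʳ (simsun n π) = none πs

open import Defs
open import Data.Nat using (ℕ; _≤_; suc; zero; _≡ᵇ_)
import Data.Nat as ℕ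
open import Data.Integer using (ℤ; +_; -[1+_]; _+_; _-_; _*_; 1ℤ)
open import Data.Integer.Properties using (pos-+; pos-*)
open import Data.Integer.Tactic.RingSolver using (solve-∀)
open import Data.Product using (_×_; _,_)
open import Relation.Binary.PropositionalEquality using (_≡_; refl; sym; trans; cong; cong₂; module ≡-Reasoning)
open PeakRecurrence using (Recurrence; recurrence; recurrence⁺; recurrence⁻; countPred; no-negative-peaks)

Recurrence⇒ℤ : ∀ {k m x a y b Y B} → + y ≡ Y → + b ≡ B → Recurrence k m x a y b →
  + x ≡ (+ k + 1ℤ) * + a + (+ m - + 2 * + k) * Y + B
Recurrence⇒ℤ {k} {m} {x} {a} {y} {b} refl refl (recurrence identity) = begin
  + x                                               ≡⟨ split (+ x) (+ k) (+ y) ⟩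
  + x + + 2 * + k * + y - + 2 * + k * + y           ≡⟨ cong (_- + 2 * + k * + y) lhs ⟩
  + (x ℕ.+ 2 ℕ.* k ℕ.* y) - + 2 * + k * + y         ≡⟨ cong (λ z → + z - + 2 * + k * + y) identity ⟩
  + ((k ℕ.+ 1) ℕ.* a ℕ.+ m ℕ.* y ℕ.+ b) - + 2 * + k * + y ≡⟨ cong (_- + 2 * + k * + y) rhs ⟩
  (+ k + 1ℤ) * + a + + m * + y + + b - + 2 * + k * + y ≡⟨ collect (+ k) (+ a) (+ m) (+ y) (+ b) ⟩
  (+ k + 1ℤ) * + a + (+ m - + 2 * + k) * + y + + b  ∎
  where
  open ≡-Reasoning
  split : ∀ x k y → x ≡ x + + 2 * k * y - + 2 * k * y
  split = solve-∀
  collect : ∀ k a m y b → (k + 1ℤ) * a + m * y + b - + 2 * k * y ≡ (k + 1ℤ) * a + (m - + 2 * k) * y + b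
  collect = solve-∀
  lhs : + x + + 2 * + k * + y ≡ + (x ℕ.+ 2 ℕ.* k ℕ.* y)
  lhs = sym (trans (pos-+ x _) (cong (_+_ (+ x)) (trans (pos-* (2 ℕ.* k) y) (cong (_* + y) (pos-* 2 k)))))
  rhs : + ((k ℕ.+ 1) ℕ.* a ℕ.+ m ℕ.* y ℕ.+ b) ≡ (+ k + 1ℤ) * + a + + m * + y + + b
  rhs = trans (pos-+ _ b) (cong (_+ + b) (trans (pos-+ _ (m ℕ.* y))
          (cong₂ _+_ (trans (pos-* (k ℕ.+ 1) a) (cong (_* + a) (pos-+ k 1))) (pos-* m y))))

P⁺-pred : ∀ n k → + countPred n startsDescent k ≡ P⁺ n (+ k - 1ℤ)
P⁺-pred n zero = cong +_ (no-negative-peaks n startsDescent)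
P⁺-pred n (suc k) = refl

P⁻-pred : ∀ n k → + countPred n startsAscent k ≡ P⁻ n (+ k - 1ℤ)
P⁻-pred n zero = cong +_ (no-negative-peaks n startsAscent)
P⁻-pred n (suc k) = refl

suc-coefficient : ∀ A a n k y b → A * a + (+ suc n - + 2 * + k) * y + b ≡ A * a + (+ n - + 2 * + k + 1ℤ) * y + b
suc-coefficient A a n k y b =
  trans (cong (λ N → A * a + (N - + 2 * + k) * y + b) (pos-+ 1 n)) (arith A a (+ n) (+ k) y b)
  where
  arith : ∀ A a n k y b → A * a + (+ 1 + n - + 2 * k) * y + b ≡ A * a + (n - + 2 * k + 1ℤ) * y + b
  arith = solve-∀

mainTheorem3 : (n : ℕ) → 2 ≤ n → (k : ℤ) →
    (P⁺ (suc n) k ≡ (k + 1ℤ) * P⁺ n k + (+ n - + 2 * k) * P⁺ n (k - 1ℤ) + P⁻ n k)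
    × (P⁻ (suc n) k ≡ (k + 1ℤ) * P⁻ n k + (+ n - + 2 * k + 1ℤ) * P⁻ n (k - 1ℤ) + P⁺ n (k - 1ℤ))
mainTheorem3 n 2≤n (+ k) =
  Recurrence⇒ℤ (P⁺-pred n k) refl (recurrence⁺ n k 2≤n) ,
  trans (Recurrence⇒ℤ (P⁻-pred n k) (P⁺-pred n k) (recurrence⁻ n k 2≤n))
        (suc-coefficient (+ k + 1ℤ) (P⁻ n (+ k)) n k _ _)
mainTheorem3 n _ -[1+ k ] =
  zeros (-[1+ k ] + 1ℤ) (+ n - + 2 * -[1+ k ]) , zeros (-[1+ k ] + 1ℤ) (+ n - + 2 * -[1+ k ] + 1ℤ)
  where
  zeros : ∀ x y → + 0 ≡ x * + 0 + y * + 0 + + 0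
  zeros = solve-∀
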